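{- For every integer $n\ge 0$, $$ \sum_{\lambda \subseteq \Delta_n} q^{|\lambda|} =1+\sum_{\substack{1 \leq i \leq n\\ i\text{ odd}}} q^i\sum_{j=0}^{n-i} q^{\binom{j+1}{2}}\begin{bmatrix} i+j\\ i\end{bmatrix}_q , $$ where the left-hand sum runs over all strict partitions $\lambda=(\lambda_1>\lambda_2>\cdots>\lambda_r>0)$ (including the empty partition) with $\lambda_1\le n$.
   Context: $|\lambda|=\sum_i\lambda_i$. The notation $\lambda\subseteq\Delta_n$ means $\lambda$ is a strict partition with largest part at most $n$ (its shifted diagram fits in the staircase $(n,n-1,\ldots,1)$). $[m]_q=1+q+\cdots+q^{m-1}$, $[m]!_q=[m]_q\cdots[1]_q$, and $\begin{bmatrix} a\\ b\end{bmatrix}_q=\frac{[a]!_q}{[b]!_q[a-b]!_q}$. -}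

module Defs where

open import Data.Bool using (Bool; true; false; _∧_)
open import Data.Nat using (ℕ; zero; suc; _+_; _*_; _∸_; _^_; _<ᵇ_; _≤ᵇ_; _≡ᵇ_; _%_; _/_; NonZero)
open import Data.Nat.Properties using (m*n≢0)
open import Data.List using (List; []; _∷_; map; concat; concatMap; upTo; applyUpTo; filterᵇ)
open import Data.Bool.ListAction using (and)
open import Data.Nat.ListAction using (sum)
open import Data.Nat.Combinatorics using (_C_)

isStrictPartition : List ℕ → Bool
isStrictPartition []            = true
isStrictPartition (x ∷ [])      = 0 <ᵇ x
isStrictPartition (x ∷ y ∷ xs)  = (y <ᵇ x) ∧ isStrictPartition (y ∷ xs)

fitsStaircase : ℕ → List ℕ → Bool
fitsStaircase n l = isStrictPartition l ∧ and (map (λ x → x ≤ᵇ n) l)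

listsOfLength : ℕ → ℕ → List (List ℕ)
listsOfLength n zero    = [] ∷ []
listsOfLength n (suc k) =
  concatMap (λ x → map (x ∷_) (listsOfLength n k)) (upTo (suc n))

-- all lists of length ≤ n with entries in {0,…,n}
-- (every strict partition with largest part ≤ n is among them)
candidates : ℕ → List (List ℕ)
candidates n = concat (map (listsOfLength n) (upTo (suc n)))

strictPartitionsIn : ℕ → List (List ℕ)
strictPartitionsIn n = filterᵇ (fitsStaircase n) (candidates n)

size : List ℕ → ℕ
size = sum

qint : ℕ → ℕ → ℕ
qint m q = sum (map (q ^_) (upTo m))

qfact : ℕ → ℕ → ℕ
qfact zero    q = 1
qfact (suc m) q = qint (suc m) q * qfact m q

qint-suc-nz : ∀ m q → NonZero (qint (suc m) q)
qint-suc-nz m q = helper (map (q ^_) (applyUpTo suc m))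
  where
  helper : (xs : List ℕ) → NonZero (1 + sum xs)
  helper xs = _

qfact-nz : ∀ m q → NonZero (qfact m q)
qfact-nz zero    q = _
qfact-nz (suc m) q =
  m*n≢0 (qint (suc m) q) (qfact m q) {{qint-suc-nz m q}} {{qfact-nz m q}}

-- [a b]_q = [a]!_q / ([b]!_q [a-b]!_q)   (exact division)
qbinom : ℕ → ℕ → ℕ → ℕ
qbinom a b q =
  _/_ (qfact a q) (qfact b q * qfact (a ∸ b) q)
    {{m*n≢0 (qfact b q) (qfact (a ∸ b) q) {{qfact-nz b q}} {{qfact-nz (a ∸ b) q}}}}

lhs : ℕ → ℕ → ℕ
lhs n q = sum (map (λ l → q ^ size l) (strictPartitionsIn n))

isOdd : ℕ → Bool
isOdd i = (i % 2) ≡ᵇ 1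

oddUpTo : ℕ → List ℕ
oddUpTo n = filterᵇ isOdd (applyUpTo suc n)

rhs : ℕ → ℕ → ℕ
rhs n q =
  1 + sum (map (λ i → q ^ i *
                  sum (map (λ j → q ^ ((j + 1) C 2) * qbinom (i + j) i q)
                           (upTo (suc (n ∸ i)))))
               (oddUpTo n))

module Submission where

-- Both sides equal ∏_{k=1}^{n} (1 + q^k).
--
-- Left side: sorting the strict partitions with parts < b by their largest
-- part x gives P(b) = 1 + Σ_{0<x<b} q^x P(x), a recursion that the products
-- P(c + 1) = ∏_{k=1}^{c} (1 + q^k) also satisfy.
--
-- Right side: group the double sum by the antidiagonals i + j = N + 1.  By
-- the q-Pascal rule the term q^i q^(j(j+1)/2) [i+j, i]_q splits as
-- u(i-1, j) + u(i, j-1), where u(a, b) = q^(N+1) q^(b(b+1)/2) [a+b, a]_q runs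
-- over the antidiagonal a + b = N.  Every (a, b) there arises from exactly one
-- odd i (namely i = a + 1 for even a and i = a for odd a), so the odd terms
-- add up to Σ_{a+b=N} u(a, b), which is q^(N+1) ∏_{k=1}^{N} (1 + q^k) by the
-- q-binomial theorem: precisely the increment of the product from N to N + 1.

open import Defs
open import Data.Nat using (ℕ)
open import Relation.Binary.PropositionalEquality using (_≡_)

open import Data.Bool.Base using (Bool; true; false; T; _∧_; if_then_else_)
open import Data.Bool.Properties using (∧-zeroʳ; ∧-identityʳ; T-∧)
open import Data.Bool.ListAction using (and)
open import Data.Empty using (⊥-elim)
open import Data.List.Base using (List; []; _∷_; map; concatMap; upTo; applyUpTo; filterᵇ)
open import Data.List.Properties using (map-++; map-∘; map-cong)
open import Data.Nat.Base
  using (zero; suc; _+_; _*_; _∸_; _^_; _%_; _<_; _≤_; _<ᵇ_; _≤ᵇ_; _≡ᵇ_; z≤n; s≤s; s≤s⁻¹; NonZero)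
open import Data.Nat.Combinatorics using (_C_; nC1≡n; nCk+nC[k+1]≡[n+1]C[k+1])
open import Data.Nat.DivMod using (/-congˡ; m*n/n≡m; [m+n]%n≡m%n)
open import Data.Nat.ListAction using (sum)
open import Data.Nat.ListAction.Properties using (sum-++)
open import Data.Nat.Properties
open import Algebra.Properties.CommutativeSemigroup +-commutativeSemigroup
  using () renaming (interchange to +-interchange)
open import Data.Nat.Tactic.RingSolver using (solve-∀)
open import Data.Sum.Base using (inj₁; inj₂)
open import Data.Unit.Base using (tt)
open import Data.Product.Base using (_,_)
open import Function.Base using (_∘_; id)
open import Function.Bundles using (Equivalence)
open import Relation.Nullary.Negation.Core using (¬_)
open import Relation.Binary.PropositionalEquality
  using (refl; sym; trans; cong; cong₂; module ≡-Reasoning)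

open ≡-Reasoning

even odd : ℕ → Bool
even zero    = true
even (suc n) = odd n
odd  zero    = false
odd  (suc n) = even n

isOdd≡odd : ∀ n → isOdd n ≡ odd n
isOdd≡odd zero          = refl
isOdd≡odd (suc zero)    = refl
isOdd≡odd (suc (suc n)) =
  trans (cong (_≡ᵇ 1) (trans (cong (_% 2) (+-comm 2 n)) ([m+n]%n≡m%n n 2))) (isOdd≡odd n)

triangular : ℕ → ℕ
triangular j = (j + 1) C 2

triangular-suc : ∀ j → triangular (suc j) ≡ triangular j + suc j
triangular-suc j = begin
    suc (j + 1) C 2            ≡⟨ nCk+nC[k+1]≡[n+1]C[k+1] (j + 1) 1 ⟨
    (j + 1) C 1 + (j + 1) C 2  ≡⟨ cong (_+ triangular j) (trans (nC1≡n (j + 1)) (+-comm j 1)) ⟩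
    suc j + triangular j       ≡⟨ +-comm (suc j) _ ⟩
    triangular j + suc j       ∎

if-T : ∀ {c : Bool} (x : ℕ) → T c → (if c then x else 0) ≡ x
if-T {true} x _ = refl

if-¬T : ∀ {c : Bool} (x : ℕ) → ¬ T c → (if c then x else 0) ≡ 0
if-¬T {true}  x ¬c = ⊥-elim (¬c tt)
if-¬T {false} x _  = refl

if-cong-T : ∀ (c : Bool) {x y : ℕ} → (T c → x ≡ y) → (if c then x else 0) ≡ (if c then y else 0)
if-cong-T true  eq = eq tt
if-cong-T false _  = refl

∧-swap-implied : ∀ s c a → (T s → T c → T a) → s ∧ (c ∧ a) ≡ c ∧ s
∧-swap-implied false c     a     _ = sym (∧-zeroʳ c)
∧-swap-implied true  false a     _ = refl
∧-swap-implied true  true  true  _ = refl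
∧-swap-implied true  true  false h = ⊥-elim (h tt tt)

-- Finite sums

∑< : ℕ → (ℕ → ℕ) → ℕ
∑< zero    f = 0
∑< (suc n) f = ∑< n f + f n

infixr 5 ∑<
syntax ∑< n (λ k → e) = ∑[ k < n ] e

∑-cong : ∀ n {f g : ℕ → ℕ} → (∀ k → k < n → f k ≡ g k) → ∑< n f ≡ ∑< n g
∑-cong zero    eq = refl
∑-cong (suc n) eq = cong₂ _+_ (∑-cong n (λ k k<n → eq k (m<n⇒m<1+n k<n))) (eq n (n<1+n n))

∑-zero : ∀ n → ∑[ k < n ] 0 ≡ 0
∑-zero zero    = refl
∑-zero (suc n) = trans (+-identityʳ _) (∑-zero n)

∑-+ : ∀ n (f g : ℕ → ℕ) → ∑[ k < n ] (f k + g k) ≡ ∑< n f + ∑< n g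
∑-+ zero    f g = refl
∑-+ (suc n) f g = trans (cong (_+ (f n + g n)) (∑-+ n f g)) (+-interchange (∑< n f) (∑< n g) (f n) (g n))

∑-*ˡ : ∀ n c (f : ℕ → ℕ) → ∑[ k < n ] c * f k ≡ c * ∑< n f
∑-*ˡ zero    c f = sym (*-zeroʳ c)
∑-*ˡ (suc n) c f = trans (cong (_+ c * f n) (∑-*ˡ n c f)) (sym (*-distribˡ-+ c _ _))

∑-if : ∀ n (c : Bool) (f : ℕ → ℕ) → ∑[ k < n ] (if c then f k else 0) ≡ (if c then ∑< n f else 0)
∑-if n true  f = refl
∑-if n false f = ∑-zero n

∑-swap : ∀ m n (f : ℕ → ℕ → ℕ) → ∑[ i < m ] ∑[ j < n ] f i j ≡ ∑[ j < n ] ∑[ i < m ] f i j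
∑-swap zero    n f = sym (∑-zero n)
∑-swap (suc m) n f = trans (cong (_+ ∑< n (f m)) (∑-swap m n f)) (sym (∑-+ n _ (f m)))

∑-front : ∀ n (f : ℕ → ℕ) → ∑< (suc n) f ≡ f 0 + (∑[ k < n ] f (suc k))
∑-front zero    f = +-comm 0 (f 0)
∑-front (suc n) f = trans (cong (_+ f (suc n)) (∑-front n f)) (+-assoc (f 0) _ _)

∑-split : ∀ m n (f : ℕ → ℕ) → ∑< (m + n) f ≡ ∑< m f + (∑[ k < n ] f (m + k))
∑-split m zero    f rewrite +-identityʳ m = sym (+-identityʳ _)
∑-split m (suc n) f rewrite +-suc m n =
  trans (cong (_+ f (m + n)) (∑-split m n f)) (+-assoc (∑< m f) _ _)

∑-truncate : ∀ n {c} (f : ℕ → ℕ) → c ≤ n → ∑[ y < n ] (if y <ᵇ c then f y else 0) ≡ ∑< c f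
∑-truncate zero    f z≤n = refl
∑-truncate (suc n) f c≤1+n with m≤n⇒m<n∨m≡n c≤1+n
... | inj₁ (s≤s c≤n) =
  trans (cong₂ _+_ (∑-truncate n f c≤n) (if-¬T (f n) (≤⇒≯ c≤n ∘ <ᵇ⇒< n _))) (+-identityʳ _)
... | inj₂ refl = ∑-cong (suc n) (λ y y<1+n → if-T (f y) (<⇒<ᵇ y<1+n))

sum-map-applyUpTo : ∀ (f g : ℕ → ℕ) n → sum (map f (applyUpTo g n)) ≡ ∑[ k < n ] f (g k)
sum-map-applyUpTo f g zero    = refl
sum-map-applyUpTo f g (suc n) =
  trans (cong (f (g 0) +_) (sum-map-applyUpTo f (g ∘ suc) n)) (sym (∑-front n (f ∘ g)))

module _ {A : Set} where

  sum-map-filterᵇ : ∀ (p : A → Bool) (f : A → ℕ) xs →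
                    sum (map f (filterᵇ p xs)) ≡ sum (map (λ x → if p x then f x else 0) xs)
  sum-map-filterᵇ p f []       = refl
  sum-map-filterᵇ p f (x ∷ xs) with p x
  ... | true  = cong (f x +_) (sum-map-filterᵇ p f xs)
  ... | false = sum-map-filterᵇ p f xs

  sum-map-*ˡ : ∀ c (f : A → ℕ) xs → sum (map (λ x → c * f x) xs) ≡ c * sum (map f xs)
  sum-map-*ˡ c f []       = sym (*-zeroʳ c)
  sum-map-*ˡ c f (x ∷ xs) = trans (cong (c * f x +_) (sum-map-*ˡ c f xs)) (sym (*-distribˡ-+ c (f x) _))

  sum-map-if : ∀ (c : Bool) (f : A → ℕ) xs →
               sum (map (λ x → if c then f x else 0) xs) ≡ (if c then sum (map f xs) else 0)
  sum-map-if true  f xs       = refl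
  sum-map-if false f []       = refl
  sum-map-if false f (x ∷ xs) = sum-map-if false f xs

  sum-map-concatMap : ∀ {B : Set} (f : B → ℕ) (g : A → List B) xs →
                      sum (map f (concatMap g xs)) ≡ sum (map (λ x → sum (map f (g x))) xs)
  sum-map-concatMap f g []       = refl
  sum-map-concatMap f g (x ∷ xs) =
    trans (cong sum (map-++ f (g x) (concatMap g xs)))
          (trans (sum-++ (map f (g x)) _) (cong (sum (map f (g x)) +_) (sum-map-concatMap f g xs)))

-- Sums over antidiagonals

∑diag : ℕ → (ℕ → ℕ → ℕ) → ℕ
∑diag zero    f = f 0 0
∑diag (suc N) f = f 0 (suc N) + ∑diag N (λ a b → f (suc a) b)

infixr 5 ∑diag
syntax ∑diag N (λ a b → e) = ∑[ a + b ≡ N ] e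

∑diag-cong : ∀ N {f g : ℕ → ℕ → ℕ} → (∀ a b → a + b ≡ N → f a b ≡ g a b) → ∑diag N f ≡ ∑diag N g
∑diag-cong zero    eq = eq 0 0 refl
∑diag-cong (suc N) eq = cong₂ _+_ (eq 0 (suc N) refl) (∑diag-cong N (λ a b e → eq (suc a) b (cong suc e)))

∑diag-+ : ∀ N (f g : ℕ → ℕ → ℕ) → ∑[ a + b ≡ N ] (f a b + g a b) ≡ ∑diag N f + ∑diag N g
∑diag-+ zero    f g = refl
∑diag-+ (suc N) f g =
  trans (cong (f 0 (suc N) + g 0 (suc N) +_) (∑diag-+ N f′ g′))
        (+-interchange (f 0 (suc N)) (g 0 (suc N)) (∑diag N f′) (∑diag N g′))
  where
  f′ g′ : ℕ → ℕ → ℕ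
  f′ a b = f (suc a) b
  g′ a b = g (suc a) b

∑diag-*ˡ : ∀ N c (f : ℕ → ℕ → ℕ) → ∑[ a + b ≡ N ] c * f a b ≡ c * ∑diag N f
∑diag-*ˡ zero    c f = refl
∑diag-*ˡ (suc N) c f = trans (cong (c * f 0 (suc N) +_) (∑diag-*ˡ N c _)) (sym (*-distribˡ-+ c _ _))

∑diag≡∑ : ∀ N (f : ℕ → ℕ → ℕ) → ∑diag N f ≡ ∑[ a < suc N ] f a (N ∸ a)
∑diag≡∑ zero    f = refl
∑diag≡∑ (suc N) f =
  trans (cong (f 0 (suc N) +_) (∑diag≡∑ N _)) (sym (∑-front (suc N) (λ a → f a (suc N ∸ a))))

n<m⇒m∸n≡suc[m∸suc[n]] : ∀ {m n} → n < m → m ∸ n ≡ suc (m ∸ suc n)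
n<m⇒m∸n≡suc[m∸suc[n]] {suc m} (s≤s n≤m) = +-∸-assoc 1 n≤m

∑-triangle : ∀ n (f : ℕ → ℕ → ℕ) → ∑[ i < n ] ∑[ j < n ∸ i ] f i j ≡ ∑[ N < n ] ∑diag N f
∑-triangle zero    f = refl
∑-triangle (suc n) f = begin
    ∑[ i < suc n ] ∑[ j < suc n ∸ i ] f i j
  ≡⟨ ∑-cong (suc n) (λ i i<1+n → cong (λ m → ∑< m (f i)) (+-∸-assoc 1 (s≤s⁻¹ i<1+n))) ⟩
    ∑[ i < suc n ] ((∑[ j < n ∸ i ] f i j) + f i (n ∸ i))
  ≡⟨ ∑-+ (suc n) _ _ ⟩
    (∑[ i < suc n ] ∑[ j < n ∸ i ] f i j) + (∑[ i < suc n ] f i (n ∸ i))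
  ≡⟨ cong₂ _+_ lastRowEmpty (sym (∑diag≡∑ n f)) ⟩
    (∑[ i < n ] ∑[ j < n ∸ i ] f i j) + ∑diag n f
  ≡⟨ cong (_+ ∑diag n f) (∑-triangle n f) ⟩
    (∑[ N < n ] ∑diag N f) + ∑diag n f
  ∎
  where
  lastRowEmpty : ∑[ i < suc n ] ∑[ j < n ∸ i ] f i j ≡ ∑[ i < n ] ∑[ j < n ∸ i ] f i j
  lastRowEmpty = trans (cong (λ m → (∑[ i < n ] ∑[ j < n ∸ i ] f i j) + ∑< m (f n)) (n∸n≡0 n))
                       (+-identityʳ _)

slide : (ℕ → ℕ → ℕ) → ℕ → ℕ → ℕ
slide f a zero    = 0
slide f a (suc b) = f (suc a) b

∑diag-slide : ∀ N (f : ℕ → ℕ → ℕ) → f 0 N + (∑[ a + b ≡ N ] slide f a b) ≡ ∑diag N f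
∑diag-slide zero    f = +-identityʳ (f 0 0)
∑diag-slide (suc N) f =
  cong (f 0 (suc N) +_)
       (trans (cong (f 1 N +_) (∑diag-cong N slide-suc)) (∑diag-slide N (λ a b → f (suc a) b)))
  where
  slide-suc : ∀ a b → a + b ≡ N → slide f (suc a) b ≡ slide (λ a b → f (suc a) b) a b
  slide-suc a zero    _ = refl
  slide-suc a (suc b) _ = refl

record SplitsDiagonally (f u : ℕ → ℕ → ℕ) : Set where
  field
    edge  : ∀ a → f (suc a) 0 ≡ u a 0
    inner : ∀ a b → f (suc a) (suc b) ≡ u (suc a) b + u a (suc b)

splitsDiagonally-suc : ∀ {f u} → SplitsDiagonally f u →
                       SplitsDiagonally (λ a b → f (suc a) b) (λ a b → u (suc a) b)
splitsDiagonally-suc s = record { edge = λ a → edge (suc a) ; inner = λ a b → inner (suc a) b }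
  where open SplitsDiagonally s

∑diag-odd≡∑diag : ∀ N {f u} → SplitsDiagonally f u →
                  ∑[ a + b ≡ N ] (if even a then f (suc a) b else 0) ≡ ∑diag N u
∑diag-even≡∑diag : ∀ N {f u} → SplitsDiagonally f u →
                   u 0 N + (∑[ a + b ≡ N ] (if odd a then f (suc a) b else 0)) ≡ ∑diag N u

∑diag-odd≡∑diag zero    s = SplitsDiagonally.edge s 0
∑diag-odd≡∑diag (suc N) {f} {u} s = begin
    f 1 (suc N) + R
  ≡⟨ cong (_+ R) (trans (SplitsDiagonally.inner s 0 N) (+-comm (u 1 N) _)) ⟩
    u 0 (suc N) + u 1 N + R
  ≡⟨ +-assoc (u 0 (suc N)) _ _ ⟩
    u 0 (suc N) + (u 1 N + R)
  ≡⟨ cong (u 0 (suc N) +_) (∑diag-even≡∑diag N (splitsDiagonally-suc s)) ⟩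
    ∑diag (suc N) u
  ∎
  where
  R : ℕ
  R = ∑[ a + b ≡ N ] (if odd a then f (suc (suc a)) b else 0)

∑diag-even≡∑diag zero    {u = u} s = +-identityʳ (u 0 0)
∑diag-even≡∑diag (suc N) {u = u} s = cong (u 0 (suc N) +_) (∑diag-odd≡∑diag N (splitsDiagonally-suc s))

-- Strict partitions

strictBelow : ℕ → List ℕ → Bool
strictBelow b []      = true
strictBelow b (x ∷ l) = (0 <ᵇ x) ∧ (x <ᵇ b) ∧ strictBelow x l

isStrictPartition-∷ : ∀ x l → isStrictPartition (x ∷ l) ≡ (0 <ᵇ x) ∧ strictBelow x l
isStrictPartition-∷ x       []          = sym (∧-identityʳ (0 <ᵇ x))
isStrictPartition-∷ zero    (y ∷ l)     = refl
isStrictPartition-∷ (suc x) (zero ∷ l)  = isStrictPartition-∷ zero l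
isStrictPartition-∷ (suc x) (suc y ∷ l) = cong ((y <ᵇ x) ∧_) (isStrictPartition-∷ (suc y) l)

strictBelow⇒parts≤ : ∀ {b n} l → T (strictBelow b l) → b ≤ n → T (and (map (_≤ᵇ n) l))
strictBelow⇒parts≤ []          _     _   = tt
strictBelow⇒parts≤ (zero ∷ l)  ()    _
strictBelow⇒parts≤ {n = n} (suc y ∷ l) below b≤n with Equivalence.to T-∧ below
... | y<b , rest = Equivalence.from T-∧ (<⇒<ᵇ y<n , strictBelow⇒parts≤ l rest y<n)
  where
  y<n : y < n
  y<n = <⇒≤ (≤-trans (<ᵇ⇒< (suc y) _ y<b) b≤n)

fitsStaircase≡strictBelow : ∀ n l → fitsStaircase n l ≡ strictBelow (suc n) l
fitsStaircase≡strictBelow n []          = refl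
fitsStaircase≡strictBelow n (zero ∷ l)  = cong (_∧ and (map (_≤ᵇ n) l)) (isStrictPartition-∷ zero l)
fitsStaircase≡strictBelow n (suc x ∷ l) =
  trans (cong (_∧ and (map (_≤ᵇ n) (suc x ∷ l))) (isStrictPartition-∷ (suc x) l))
        (∧-swap-implied (strictBelow (suc x) l) (x <ᵇ n) _
                        (λ below x<n → strictBelow⇒parts≤ l below (<ᵇ⇒< x n x<n)))

module _ (q : ℕ) where

  ∏[1+qᵏ] : ℕ → ℕ
  ∏[1+qᵏ] zero    = 1
  ∏[1+qᵏ] (suc n) = (1 + q ^ suc n) * ∏[1+qᵏ] n

  ∏[1+qᵏ]-as-∑ : ∀ n → 1 + (∑[ k < n ] q ^ suc k * ∏[1+qᵏ] k) ≡ ∏[1+qᵏ] n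
  ∏[1+qᵏ]-as-∑ zero    = refl
  ∏[1+qᵏ]-as-∑ (suc n) =
    trans (sym (+-assoc 1 _ (q ^ suc n * ∏[1+qᵏ] n))) (cong (_+ q ^ suc n * ∏[1+qᵏ] n) (∏[1+qᵏ]-as-∑ n))

  weight : ℕ → List ℕ → ℕ
  weight b l = if strictBelow b l then q ^ sum l else 0

  weight-∷ : ∀ b x l → weight b (x ∷ l) ≡ (if (0 <ᵇ x) ∧ (x <ᵇ b) then q ^ x * weight x l else 0)
  weight-∷ b x l with 0 <ᵇ x | x <ᵇ b | strictBelow x l
  ... | true  | true  | true  = ^-distribˡ-+-* q x (sum l)
  ... | true  | true  | false = sym (*-zeroʳ (q ^ x))
  ... | true  | false | _     = refl
  ... | false | _     | _     = refl

  module _ (n : ℕ) where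

    weightOfLength : ℕ → ℕ → ℕ
    weightOfLength k b = sum (map (weight b) (listsOfLength n k))

    weightOfLength-suc : ∀ k b → weightOfLength (suc k) b
                         ≡ ∑[ y < n ] (if suc y <ᵇ b then q ^ suc y * weightOfLength k (suc y) else 0)
    weightOfLength-suc k b = begin
        sum (map (weight b) (concatMap (λ x → map (x ∷_) (listsOfLength n k)) (upTo (suc n))))
      ≡⟨ sum-map-concatMap (weight b) (λ x → map (x ∷_) (listsOfLength n k)) (upTo (suc n)) ⟩
        sum (map (λ x → sum (map (weight b) (map (x ∷_) (listsOfLength n k)))) (upTo (suc n)))
      ≡⟨ sum-map-applyUpTo (λ x → sum (map (weight b) (map (x ∷_) (listsOfLength n k)))) id (suc n) ⟩
        ∑[ x < suc n ] sum (map (weight b) (map (x ∷_) (listsOfLength n k)))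
      ≡⟨ ∑-cong (suc n) (λ x _ → prepend x) ⟩
        ∑[ x < suc n ] (if (0 <ᵇ x) ∧ (x <ᵇ b) then q ^ x * weightOfLength k x else 0)
      ≡⟨ ∑-front n _ ⟩
        ∑[ y < n ] (if suc y <ᵇ b then q ^ suc y * weightOfLength k (suc y) else 0)
      ∎
      where
      prepend : ∀ x → sum (map (weight b) (map (x ∷_) (listsOfLength n k)))
                      ≡ (if (0 <ᵇ x) ∧ (x <ᵇ b) then q ^ x * weightOfLength k x else 0)
      prepend x = begin
          sum (map (weight b) (map (x ∷_) Ls))
        ≡⟨ cong sum (map-∘ Ls) ⟨
          sum (map (λ l → weight b (x ∷ l)) Ls)
        ≡⟨ cong sum (map-cong (weight-∷ b x) Ls) ⟩
          sum (map (λ l → if (0 <ᵇ x) ∧ (x <ᵇ b) then q ^ x * weight x l else 0) Ls)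
        ≡⟨ sum-map-if ((0 <ᵇ x) ∧ (x <ᵇ b)) _ Ls ⟩
          (if (0 <ᵇ x) ∧ (x <ᵇ b) then sum (map (λ l → q ^ x * weight x l) Ls) else 0)
        ≡⟨ cong (λ t → if (0 <ᵇ x) ∧ (x <ᵇ b) then t else 0) (sum-map-*ˡ (q ^ x) (weight x) Ls) ⟩
          (if (0 <ᵇ x) ∧ (x <ᵇ b) then q ^ x * weightOfLength k x else 0)
        ∎
        where
        Ls : List (List ℕ)
        Ls = listsOfLength n k

    weightUpToLength : ℕ → ℕ → ℕ
    weightUpToLength m b = ∑[ k < suc m ] weightOfLength k b

    weightUpToLength-suc : ∀ m b → weightUpToLength (suc m) b
                           ≡ 1 + (∑[ y < n ] (if suc y <ᵇ b then q ^ suc y * weightUpToLength m (suc y) else 0))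
    weightUpToLength-suc m b = begin
        ∑[ k < suc (suc m) ] weightOfLength k b
      ≡⟨ ∑-front (suc m) _ ⟩
        1 + (∑[ k < suc m ] weightOfLength (suc k) b)
      ≡⟨ cong (1 +_) (∑-cong (suc m) (λ k _ → weightOfLength-suc k b)) ⟩
        1 + (∑[ k < suc m ] ∑[ y < n ] term k y)
      ≡⟨ cong (1 +_) (∑-swap (suc m) n term) ⟩
        1 + (∑[ y < n ] ∑[ k < suc m ] term k y)
      ≡⟨ cong (1 +_) (∑-cong n (λ y _ → pull y)) ⟩
        1 + (∑[ y < n ] (if suc y <ᵇ b then q ^ suc y * weightUpToLength m (suc y) else 0))
      ∎
      where
      term : ℕ → ℕ → ℕ
      term k y = if suc y <ᵇ b then q ^ suc y * weightOfLength k (suc y) else 0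
      pull : ∀ y → ∑[ k < suc m ] term k y
                   ≡ (if suc y <ᵇ b then q ^ suc y * weightUpToLength m (suc y) else 0)
      pull y = trans (∑-if (suc m) (suc y <ᵇ b) _)
                     (cong (λ t → if suc y <ᵇ b then t else 0) (∑-*ˡ (suc m) (q ^ suc y) _))

    -- Lengths up to m suffice: a strict partition with parts ≤ c has at most c ≤ m parts.
    weightUpToLength≡∏ : ∀ m c → c ≤ m → c ≤ n → weightUpToLength m (suc c) ≡ ∏[1+qᵏ] c
    weightUpToLength≡∏ zero    zero z≤n _ = refl
    weightUpToLength≡∏ (suc m) c c≤1+m c≤n = begin
        weightUpToLength (suc m) (suc c)
      ≡⟨ weightUpToLength-suc m (suc c) ⟩
        1 + (∑[ y < n ] (if y <ᵇ c then q ^ suc y * weightUpToLength m (suc y) else 0))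
      ≡⟨ cong (1 +_) (∑-cong n (λ y y<n → if-cong-T (y <ᵇ c) (cong (q ^ suc y *_) ∘ induction y y<n))) ⟩
        1 + (∑[ y < n ] (if y <ᵇ c then q ^ suc y * ∏[1+qᵏ] y else 0))
      ≡⟨ cong (1 +_) (∑-truncate n _ c≤n) ⟩
        1 + (∑[ y < c ] q ^ suc y * ∏[1+qᵏ] y)
      ≡⟨ ∏[1+qᵏ]-as-∑ c ⟩
        ∏[1+qᵏ] c
      ∎
      where
      induction : ∀ y → y < n → T (y <ᵇ c) → weightUpToLength m (suc y) ≡ ∏[1+qᵏ] y
      induction y y<n y<c = weightUpToLength≡∏ m y (s≤s⁻¹ (≤-trans (<ᵇ⇒< y c y<c) c≤1+m)) (<⇒≤ y<n)

  lhs≡∏ : ∀ n → lhs n q ≡ ∏[1+qᵏ] n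
  lhs≡∏ n = begin
      sum (map (λ l → q ^ size l) (filterᵇ (fitsStaircase n) (candidates n)))
    ≡⟨ sum-map-filterᵇ (fitsStaircase n) (λ l → q ^ size l) (candidates n) ⟩
      sum (map (λ l → if fitsStaircase n l then q ^ size l else 0) (candidates n))
    ≡⟨ cong sum (map-cong fits≡below (candidates n)) ⟩
      sum (map (weight (suc n)) (candidates n))
    ≡⟨ sum-map-concatMap (weight (suc n)) (listsOfLength n) (upTo (suc n)) ⟩
      sum (map (λ k → weightOfLength n k (suc n)) (upTo (suc n)))
    ≡⟨ sum-map-applyUpTo (λ k → weightOfLength n k (suc n)) id (suc n) ⟩
      weightUpToLength n n (suc n)
    ≡⟨ weightUpToLength≡∏ n n n ≤-refl ≤-refl ⟩
      ∏[1+qᵏ] n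
    ∎
    where
    fits≡below : ∀ l → (if fitsStaircase n l then q ^ size l else 0) ≡ weight (suc n) l
    fits≡below l = cong (λ c → if c then q ^ size l else 0) (fitsStaircase≡strictBelow n l)

  -- Gaussian binomial coefficients

  qint-+ : ∀ m n → qint (m + n) q ≡ qint m q + q ^ m * qint n q
  qint-+ m n = begin
      sum (map (q ^_) (upTo (m + n)))
    ≡⟨ sum-map-applyUpTo (q ^_) id (m + n) ⟩
      ∑[ k < m + n ] q ^ k
    ≡⟨ ∑-split m n (q ^_) ⟩
      (∑[ k < m ] q ^ k) + (∑[ k < n ] q ^ (m + k))
    ≡⟨ cong₂ _+_ (sym (sum-map-applyUpTo (q ^_) id m)) (∑-cong n (λ k _ → ^-distribˡ-+-* q m k)) ⟩
      qint m q + (∑[ k < n ] q ^ m * q ^ k)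
    ≡⟨ cong (qint m q +_) (∑-*ˡ n (q ^ m) (q ^_)) ⟩
      qint m q + q ^ m * (∑[ k < n ] q ^ k)
    ≡⟨ cong (λ t → qint m q + q ^ m * t) (sum-map-applyUpTo (q ^_) id n) ⟨
      qint m q + q ^ m * qint n q
    ∎

  gaussian : ℕ → ℕ → ℕ
  gaussian zero    b       = 1
  gaussian (suc a) zero    = 1
  gaussian (suc a) (suc b) = gaussian (suc a) b + q ^ suc b * gaussian a (suc b)

  gaussian-zeroʳ : ∀ a → gaussian a 0 ≡ 1
  gaussian-zeroʳ zero    = refl
  gaussian-zeroʳ (suc a) = refl

  qfact-+ : ∀ a b → qfact (a + b) q ≡ gaussian a b * (qfact a q * qfact b q)
  qfact-+ zero    b    = sym (trans (*-identityˡ _) (*-identityˡ _))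
  qfact-+ (suc a) zero =
    trans (cong (λ m → qfact m q) (+-identityʳ (suc a))) (sym (trans (*-identityˡ _) (*-identityʳ _)))
  qfact-+ (suc a) (suc b) = begin
      qint (suc a + suc b) q * X
    ≡⟨ cong (λ m → qint m q * X) (+-comm (suc a) (suc b)) ⟩
      qint (suc b + suc a) q * X
    ≡⟨ cong (_* X) (qint-+ (suc b) (suc a)) ⟩
      (Ib + q ^ suc b * Ia) * X
    ≡⟨ *-distribʳ-+ X Ib (q ^ suc b * Ia) ⟩
      Ib * X + q ^ suc b * Ia * X
    ≡⟨ cong₂ (λ s t → Ib * s + q ^ suc b * Ia * t)
             (trans (cong (λ m → qfact m q) (+-suc a b)) (qfact-+ (suc a) b)) (qfact-+ a (suc b)) ⟩
      Ib * (gaussian (suc a) b * (Ia * fa * fb)) + q ^ suc b * Ia * (gaussian a (suc b) * (fa * (Ib * fb)))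
    ≡⟨ identity Ib (q ^ suc b) Ia fa fb (gaussian (suc a) b) (gaussian a (suc b)) ⟩
      (gaussian (suc a) b + q ^ suc b * gaussian a (suc b)) * (Ia * fa * (Ib * fb))
    ∎
    where
    X Ia Ib fa fb : ℕ
    X  = qfact (a + suc b) q
    Ia = qint (suc a) q
    Ib = qint (suc b) q
    fa = qfact a q
    fb = qfact b q
    identity : ∀ Ib Qb Ia fa fb g₁ g₂ → Ib * (g₁ * (Ia * fa * fb)) + Qb * Ia * (g₂ * (fa * (Ib * fb)))
                                        ≡ (g₁ + Qb * g₂) * (Ia * fa * (Ib * fb))
    identity = solve-∀

  qfact*qfact-nonZero : ∀ a b → NonZero (qfact a q * qfact b q)
  qfact*qfact-nonZero a b = m*n≢0 (qfact a q) (qfact b q) {{qfact-nz a q}} {{qfact-nz b q}}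

  qbinom≡gaussian : ∀ a b → qbinom (a + b) a q ≡ gaussian a b
  qbinom≡gaussian a b =
    trans (/-congˡ {{nonZero}} numerator) (m*n/n≡m (gaussian a b) _ {{nonZero}})
    where
    nonZero : NonZero (qfact a q * qfact (a + b ∸ a) q)
    nonZero = qfact*qfact-nonZero a (a + b ∸ a)
    numerator : qfact (a + b) q ≡ gaussian a b * (qfact a q * qfact (a + b ∸ a) q)
    numerator = trans (qfact-+ a b) (cong (λ m → gaussian a b * (qfact a q * qfact m q)) (sym (m+n∸m≡n a b)))

  gaussian-comm : ∀ a b → gaussian a b ≡ gaussian b a
  gaussian-comm a b = *-cancelʳ-≡ _ _ (qfact a q * qfact b q) {{qfact*qfact-nonZero a b}} (begin
      gaussian a b * (qfact a q * qfact b q)  ≡⟨ qfact-+ a b ⟨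
      qfact (a + b) q                         ≡⟨ cong (λ m → qfact m q) (+-comm a b) ⟩
      qfact (b + a) q                         ≡⟨ qfact-+ b a ⟩
      gaussian b a * (qfact b q * qfact a q)  ≡⟨ cong (gaussian b a *_) (*-comm (qfact b q) (qfact a q)) ⟩
      gaussian b a * (qfact a q * qfact b q)  ∎)

  gaussian-pascal′ : ∀ a b → gaussian (suc a) (suc b) ≡ gaussian a (suc b) + q ^ suc a * gaussian (suc a) b
  gaussian-pascal′ a b = trans (gaussian-comm (suc a) (suc b))
    (cong₂ (λ x y → x + q ^ suc a * y) (gaussian-comm (suc b) a) (gaussian-comm b (suc a)))

  -- The right-hand side

  q^triangular-suc : ∀ b → q ^ triangular (suc b) ≡ q ^ triangular b * (q * q ^ b)
  q^triangular-suc b = trans (cong (q ^_) (triangular-suc b)) (^-distribˡ-+-* q (triangular b) (suc b))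

  q^-+-suc : ∀ a b → q ^ (a + suc b) ≡ q * (q ^ a * q ^ b)
  q^-+-suc a b = trans (cong (q ^_) (+-suc a b)) (cong (q *_) (^-distribˡ-+-* q a b))

  binomialTerm : ℕ → ℕ → ℕ
  binomialTerm a b = q ^ triangular b * gaussian a b

  binomialTerm-0-suc : ∀ N → binomialTerm 0 (suc N) ≡ q ^ suc N * binomialTerm 0 N
  binomialTerm-0-suc N = trans (cong (_* 1) (q^triangular-suc N)) (identity (q ^ triangular N) (q * q ^ N))
    where
    identity : ∀ t c → t * c * 1 ≡ c * (t * 1)
    identity = solve-∀

  binomialTerm-suc : ∀ {N} a b → a + b ≡ N →
                     binomialTerm (suc a) b ≡ binomialTerm a b + q ^ suc N * slide binomialTerm a b
  binomialTerm-suc {N} a zero refl rewrite gaussian-zeroʳ a | *-zeroʳ (q ^ suc N) = refl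
  binomialTerm-suc a (suc b) refl rewrite gaussian-pascal′ a b | q^triangular-suc b | q^-+-suc a b =
    identity q (q ^ a) (q ^ b) (q ^ triangular b) (gaussian a (suc b)) (gaussian (suc a) b)
    where
    identity : ∀ q x y t g₁ g₂ → t * (q * y) * (g₁ + q * x * g₂)
                                 ≡ t * (q * y) * g₁ + q * (q * (x * y)) * (t * g₂)
    identity = solve-∀

  q-binomial-theorem : ∀ N → ∑[ a + b ≡ N ] binomialTerm a b ≡ ∏[1+qᵏ] N
  q-binomial-theorem zero    = refl
  q-binomial-theorem (suc N) = begin
      binomialTerm 0 (suc N) + (∑[ a + b ≡ N ] binomialTerm (suc a) b)
    ≡⟨ cong₂ _+_ (binomialTerm-0-suc N) (∑diag-cong N binomialTerm-suc) ⟩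
      c * binomialTerm 0 N + (∑[ a + b ≡ N ] (binomialTerm a b + c * slide binomialTerm a b))
    ≡⟨ cong (c * binomialTerm 0 N +_) (trans (∑diag-+ N binomialTerm _) (cong (S +_) (∑diag-*ˡ N c _))) ⟩
      c * binomialTerm 0 N + (S + c * ∑diag N (slide binomialTerm))
    ≡⟨ identity c (binomialTerm 0 N) S (∑diag N (slide binomialTerm)) ⟩
      S + c * (binomialTerm 0 N + ∑diag N (slide binomialTerm))
    ≡⟨ cong (λ t → S + c * t) (∑diag-slide N binomialTerm) ⟩
      S + c * S
    ≡⟨ cong (λ t → t + c * t) (q-binomial-theorem N) ⟩
      ∏[1+qᵏ] N + c * ∏[1+qᵏ] N
    ∎
    where
    c S : ℕ
    c = q ^ suc N
    S = ∑diag N binomialTerm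
    identity : ∀ c h s v → c * h + (s + c * v) ≡ s + c * (h + v)
    identity = solve-∀

  binomialTerms-splitDiagonally : SplitsDiagonally (λ a b → q ^ a * binomialTerm a b)
                                                   (λ a b → q ^ suc (a + b) * binomialTerm a b)
  binomialTerms-splitDiagonally = record { edge = edge ; inner = inner }
    where
    edge : ∀ a → q ^ suc a * binomialTerm (suc a) 0 ≡ q ^ suc (a + 0) * binomialTerm a 0
    edge a = cong₂ (λ m g → q ^ suc m * (q ^ triangular 0 * g)) (sym (+-identityʳ a)) (sym (gaussian-zeroʳ a))
    inner : ∀ a b → q ^ suc a * binomialTerm (suc a) (suc b)
                    ≡ q ^ suc (suc a + b) * binomialTerm (suc a) b + q ^ suc (a + suc b) * binomialTerm a (suc b)
    inner a b rewrite q^triangular-suc b | q^-+-suc a b | ^-distribˡ-+-* q a b =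
      identity q (q ^ a) (q ^ b) (q ^ triangular b) (gaussian (suc a) b) (gaussian a (suc b))
      where
      identity : ∀ q x y t g₁ g₂ → q * x * (t * (q * y) * (g₁ + q * y * g₂))
                                   ≡ q * (q * (x * y)) * (t * g₁) + q * (q * (x * y)) * (t * (q * y) * g₂)
      identity = solve-∀

  oddTerm : ℕ → ℕ → ℕ
  oddTerm i j = if odd i then q ^ i * binomialTerm i j else 0

  ∑diag-oddTerm : ∀ N → ∑[ a + b ≡ N ] oddTerm (suc a) b ≡ q ^ suc N * ∏[1+qᵏ] N
  ∑diag-oddTerm N = begin
      ∑[ a + b ≡ N ] oddTerm (suc a) b
    ≡⟨ ∑diag-odd≡∑diag N binomialTerms-splitDiagonally ⟩
      ∑[ a + b ≡ N ] q ^ suc (a + b) * binomialTerm a b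
    ≡⟨ ∑diag-cong N (λ a b a+b≡N → cong (λ m → q ^ suc m * binomialTerm a b) a+b≡N) ⟩
      ∑[ a + b ≡ N ] q ^ suc N * binomialTerm a b
    ≡⟨ ∑diag-*ˡ N (q ^ suc N) binomialTerm ⟩
      q ^ suc N * ∑diag N binomialTerm
    ≡⟨ cong (q ^ suc N *_) (q-binomial-theorem N) ⟩
      q ^ suc N * ∏[1+qᵏ] N
    ∎

  rhs≡∏ : ∀ n → rhs n q ≡ ∏[1+qᵏ] n
  rhs≡∏ n = trans (cong (1 +_) rows) (∏[1+qᵏ]-as-∑ n)
    where
    row : ℕ → ℕ
    row i = q ^ i * sum (map (λ j → q ^ ((j + 1) C 2) * qbinom (i + j) i q) (upTo (suc (n ∸ i))))

    row≡∑ : ∀ k → k < n → row (suc k) ≡ ∑[ j < n ∸ k ] q ^ suc k * binomialTerm (suc k) j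
    row≡∑ k k<n = begin
        q ^ suc k * sum (map (λ j → q ^ triangular j * qbinom (suc k + j) (suc k) q) (upTo (suc (n ∸ suc k))))
      ≡⟨ cong (q ^ suc k *_) (sum-map-applyUpTo _ id (suc (n ∸ suc k))) ⟩
        q ^ suc k * (∑[ j < suc (n ∸ suc k) ] q ^ triangular j * qbinom (suc k + j) (suc k) q)
      ≡⟨ cong (q ^ suc k *_) 
                               (∑-cong (suc (n ∸ suc k)) (λ j _ → cong (q ^ triangular j *_) (qbinom≡gaussian (suc k) j))) ⟩
        q ^ suc k * ∑< (suc (n ∸ suc k)) (binomialTerm (suc k))
      ≡⟨ cong (λ m → q ^ suc k * ∑< m (binomialTerm (suc k))) (n<m⇒m∸n≡suc[m∸suc[n]] k<n) ⟨
        q ^ suc k * ∑< (n ∸ k) (binomialTerm (suc k))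
      ≡⟨ ∑-*ˡ (n ∸ k) (q ^ suc k) (binomialTerm (suc k)) ⟨
        ∑[ j < n ∸ k ] q ^ suc k * binomialTerm (suc k) j
      ∎

    oddRow≡∑ : ∀ k → k < n → (if isOdd (suc k) then row (suc k) else 0) ≡ ∑[ j < n ∸ k ] oddTerm (suc k) j
    oddRow≡∑ k k<n = trans (cong₂ (λ c t → if c then t else 0) (isOdd≡odd (suc k)) (row≡∑ k k<n))
                           (sym (∑-if (n ∸ k) (odd (suc k)) (λ j → q ^ suc k * binomialTerm (suc k) j)))

    rows : sum (map row (oddUpTo n)) ≡ ∑[ N < n ] q ^ suc N * ∏[1+qᵏ] N
    rows = begin
        sum (map row (filterᵇ isOdd (applyUpTo suc n)))
      ≡⟨ sum-map-filterᵇ isOdd row (applyUpTo suc n) ⟩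
        sum (map (λ i → if isOdd i then row i else 0) (applyUpTo suc n))
      ≡⟨ sum-map-applyUpTo (λ i → if isOdd i then row i else 0) suc n ⟩
        ∑[ k < n ] (if isOdd (suc k) then row (suc k) else 0)
      ≡⟨ ∑-cong n oddRow≡∑ ⟩
        ∑[ k < n ] ∑[ j < n ∸ k ] oddTerm (suc k) j
      ≡⟨ ∑-triangle n (λ a b → oddTerm (suc a) b) ⟩
        ∑[ N < n ] ∑[ a + b ≡ N ] oddTerm (suc a) b
      ≡⟨ ∑-cong n (λ N _ → ∑diag-oddTerm N) ⟩
        ∑[ N < n ] q ^ suc N * ∏[1+qᵏ] N
      ∎

proposition5p2 : (n q : ℕ) → lhs n q ≡ rhs n q
proposition5p2 n q = trans (lhs≡∏ q n) (sym (rhs≡∏ q n))
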